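{- Let $c \in \mathbb{Z}^d$, $\lambda \in \mathbb{Z}$, and $w = \text{Dual-Greedy}(c,\lambda)$. If $w$ has exactly $k$ active constraints, then $w$ is an optimal solution of the LP $\mathcal{D}$.
   Context: $\Delta, k$ are positive integers. $\mathcal{D}$ is the LP in variables $w_0 \in \mathbb{R}$, $w_1,\dots,w_d$: minimize $w_0 k + \sum_{i=1}^d w_i$ subject to $w_0 + \sum_{j=\max\{1,i-\Delta+1\}}^{i} w_j \ge c_i$ for $i=1,\dots,d$, and $w_i \ge 0$ for $i = 1,\dots,d$. Dual-Greedy$(c,\lambda)$ returns the vector $w$ with $w_0 = \lambda$ and, for $i = 1,\dots,d$ in increasing order, $w_i = \max\{0,\ c_i - (w_0 + \sum_{j=\max\{1,i-\Delta+1\}}^{i-1} w_j)\}$. Active constraints: for $w = \text{Dual-Greedy}(c,\lambda)$ with $\lambda \in \mathbb{Z}$ and $w' = \text{Dual-Greedy}(c,\lambda - \varepsilon)$ for a fixed small $\varepsilon \in (0,1)$, the active constraints of $w$ are the indices $i \in [d]$ with $w'_i = w_i + \varepsilon$.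
   Formalization: The variables of the LP $\mathcal{D}$ take rational rather than real values, so the optimality of w is checked only against rational feasible points. -}

module Defs where

open import Data.Nat as ℕ using (ℕ; zero; suc; _∸_; _⊔_; _<?_)
open import Data.Integer as ℤ using (ℤ)
open import Data.Fin using (Fin; fromℕ<)
open import Data.List using (List; []; _∷_; take; foldr)
open import Data.Rational using (ℚ; 0ℚ; _+_; _-_; _*_; _≤_; _/_)
  renaming (_⊔_ to _⊔ℚ_)
open import Data.Rational.Properties using (_≟_)
open import Data.Product using (_×_)
open import Relation.Nullary.Decidable using (yes; no; ⌊_⌋)
open import Data.Bool using (if_then_else_)

-- Vectors indexed 1..d are represented as functions ℕ → ℚ (only 1..d matter).

sumFrom : (ℕ → ℚ) → ℕ → ℕ → ℚ
sumFrom f a zero = 0ℚ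
sumFrom f a (suc n) = f a + sumFrom f (suc a) n

toℚ : ℤ → ℚ
toℚ z = z / 1

-- c ∈ ℤ^d (as Fin d → ℤ) seen as the 1-indexed sequence c_1..c_d (0 elsewhere)
cAt : {d : ℕ} → (Fin d → ℤ) → ℕ → ℚ
cAt c zero = 0ℚ
cAt {d} c (suc i) with i <? d
... | yes p = toℚ (c (fromℕ< p))
... | no _ = 0ℚ

winStart : ℕ → ℕ → ℕ
winStart Δ i = 1 ⊔ (suc i ∸ Δ)

windowSum : ℕ → (ℕ → ℚ) → ℕ → ℚ
windowSum Δ w i = sumFrom w (winStart Δ i) (suc i ∸ winStart Δ i)

Feasible : (Δ d : ℕ) → (ℕ → ℚ) → ℚ → (ℕ → ℚ) → Set
Feasible Δ d c w₀ w =
  (∀ i → 1 ℕ.≤ i → i ℕ.≤ d → c i ≤ w₀ + windowSum Δ w i) ×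
  (∀ i → 1 ℕ.≤ i → i ℕ.≤ d → 0ℚ ≤ w i)

objective : (k d : ℕ) → ℚ → (ℕ → ℚ) → ℚ
objective k d w₀ w = w₀ * (ℤ.+ k / 1) + sumFrom w 1 d

Optimal : (Δ k d : ℕ) → (ℕ → ℚ) → ℚ → (ℕ → ℚ) → Set
Optimal Δ k d c w₀ w =
  Feasible Δ d c w₀ w ×
  (∀ (v₀ : ℚ) (v : ℕ → ℚ) → Feasible Δ d c v₀ v →
     objective k d w₀ w ≤ objective k d v₀ v)

-- Dual-Greedy: the list [w_i, w_{i-1}, ..., w_1] (most recent first)
greedyList : (Δ : ℕ) → (ℕ → ℚ) → ℚ → ℕ → List ℚ
greedyList Δ c w₀ zero = []
greedyList Δ c w₀ (suc i) =
  let prev = greedyList Δ c w₀ i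
      s    = w₀ + foldr _+_ 0ℚ (take (Δ ∸ 1) prev)   -- w₀ + ∑_{j=max{1,i-Δ+1}}^{i-1} w_j
  in (0ℚ ⊔ℚ (c (suc i) - s)) ∷ prev

-- w_i of Dual-Greedy(c, w₀)  (w₀ = λ); index 0 is unused and set to 0
dualGreedy : (Δ : ℕ) → (ℕ → ℚ) → ℚ → ℕ → ℚ
dualGreedy Δ c w₀ i with greedyList Δ c w₀ i
... | [] = 0ℚ
... | x ∷ _ = x

-- number of active constraints of w = Dual-Greedy(c,λ), using w' = Dual-Greedy(c,λ-ε):
-- #{ i ∈ [d] : w'_i = w_i + ε }
activeCount : (Δ d : ℕ) → (ℕ → ℚ) → ℚ → ℚ → ℕ
activeCount Δ d c lam ε = go 1 d
  where
  go : ℕ → ℕ → ℕ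
  go i zero = 0
  go i (suc n) =
    (if ⌊ dualGreedy Δ c (lam - ε) i ≟ dualGreedy Δ c lam i + ε ⌋ then 1 else 0)
    ℕ.+ go (suc i) n

{-# OPTIONS --safe #-}
module Submission where

open import Defs
open import Data.Nat as ℕ using (ℕ; zero; suc; _∸_; z≤n; s≤s)
import Data.Nat.Properties as ℕₚ
open import Data.Nat.Induction using (<-rec)
open import Data.Integer as ℤ using (ℤ)
import Data.Integer.Properties as ℤₚ
open import Data.Fin using (Fin; fromℕ<)
open import Data.Rational using (ℚ; 0ℚ; 1ℚ; _+_; _-_; _*_; -_; _≤_; _<_; _⊔_; toℚᵘ)
open import Data.Rational.Properties
import Data.Rational.Unnormalised as ℚᵘ
import Data.Rational.Unnormalised.Properties as ℚᵘₚ
open import Data.Rational.Solver using (module +-*-Solver)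
open +-*-Solver using (solve; con; _:+_; _:-_; _:*_; _:=_)
open import Algebra.Properties.Group +-0-group using (identityʳ-unique)
open import Data.List using (List; take; foldr)
open import Data.List.Relation.Unary.All using (All; []; _∷_)
open import Data.List.Relation.Unary.All.Properties using (take⁺)
open import Data.Bool using (if_then_else_)
open import Data.Product using (∃-syntax; _×_; _,_; proj₁)
open import Data.Sum using (_⊎_; inj₁; inj₂)
open import Relation.Nullary using (yes; no; contradiction)
open import Relation.Nullary.Decidable using (⌊_⌋)
open import Relation.Binary.PropositionalEquality

-- Let g = Dual-Greedy(c, λ) and h = Dual-Greedy(c, λ - ε), and call the deficit of constraint i
-- what it still lacks, c_i - (λ + the earlier g_j of its window), when g_i = max(0, deficit) is
-- chosen.  Along the constraints one shows inductively that h_i = g_i + ε [i active] and that every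
-- window of Δ consecutive constraints contains at most one active constraint: for h the deficit of
-- constraint i is larger by ε exactly when no active constraint precedes i in its window, and as c
-- and λ are integral a negative deficit stays negative after adding ε < 1.  So every constraint i
-- either has g_i = 0 and is inactive, or is tight for g with exactly one active constraint in its
-- window.  Summing these steps gives λ A(n) + Σ_{j ≤ n} g_j ≤ v₀ A(n) + Σ_{j ≤ n} v_j for every
-- feasible (v₀, v), where A(n) counts the active constraints among the first n; and A(d) = k.

prefixSum : (ℕ → ℚ) → ℕ → ℚ
prefixSum f zero    = 0ℚ
prefixSum f (suc n) = prefixSum f n + f (suc n)

sumFrom-prefixSum : ∀ f a n → sumFrom f (suc a) n ≡ prefixSum f (a ℕ.+ n) - prefixSum f a
sumFrom-prefixSum f a zero = begin
  0ℚ                                  ≡⟨ +-inverseʳ (prefixSum f a) ⟨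
  prefixSum f a - prefixSum f a       ≡⟨ cong (λ n → prefixSum f n - prefixSum f a) (ℕₚ.+-identityʳ a) ⟨
  prefixSum f (a ℕ.+ 0) - prefixSum f a ∎
  where open ≡-Reasoning
sumFrom-prefixSum f a (suc n) = begin
  f (suc a) + sumFrom f (suc (suc a)) n
    ≡⟨ cong (f (suc a) +_) (sumFrom-prefixSum f (suc a) n) ⟩
  f (suc a) + (prefixSum f (suc a ℕ.+ n) - (prefixSum f a + f (suc a)))
    ≡⟨ solve 3 (λ x y z → y :+ (x :- (z :+ y)) := x :- z) refl
         (prefixSum f (suc a ℕ.+ n)) (f (suc a)) (prefixSum f a) ⟩
  prefixSum f (suc a ℕ.+ n) - prefixSum f a
    ≡⟨ cong (λ m → prefixSum f m - prefixSum f a) (ℕₚ.+-suc a n) ⟨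
  prefixSum f (a ℕ.+ suc n) - prefixSum f a ∎
  where open ≡-Reasoning

sumFrom-one : ∀ f n → sumFrom f 1 n ≡ prefixSum f n
sumFrom-one f n = trans (sumFrom-prefixSum f 0 n) (+-identityʳ (prefixSum f n))

winStart-suc : ∀ D m → winStart (suc D) (suc m) ≡ suc (m ∸ D)
winStart-suc zero          m       = refl
winStart-suc (suc zero)    zero    = refl
winStart-suc (suc (suc D)) zero    = refl
winStart-suc (suc D)       (suc m) = winStart-suc D m

windowSum-prefixSum : ∀ D f m → windowSum (suc D) f (suc m) ≡ prefixSum f (suc m) - prefixSum f (m ∸ D)
windowSum-prefixSum D f m = begin
  windowSum (suc D) f (suc m)
    ≡⟨ cong (λ a → sumFrom f a (suc (suc m) ∸ a)) (winStart-suc D m) ⟩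
  sumFrom f (suc (m ∸ D)) (suc m ∸ (m ∸ D))
    ≡⟨ sumFrom-prefixSum f (m ∸ D) (suc m ∸ (m ∸ D)) ⟩
  prefixSum f (m ∸ D ℕ.+ (suc m ∸ (m ∸ D))) - prefixSum f (m ∸ D)
    ≡⟨ cong (λ n → prefixSum f n - prefixSum f (m ∸ D))
         (ℕₚ.m+[n∸m]≡n (ℕₚ.≤-trans (ℕₚ.m∸n≤m m D) (ℕₚ.n≤1+n m))) ⟩
  prefixSum f (suc m) - prefixSum f (m ∸ D) ∎
  where open ≡-Reasoning

IsInteger : ℚ → Set
IsInteger p = ∃[ z ] p ≡ toℚ z

toℚᵘ-toℚ : ∀ z → toℚᵘ (toℚ z) ℚᵘ.≃ ℚᵘ.mkℚᵘ z 0
toℚᵘ-toℚ z = toℚᵘ-fromℚᵘ (ℚᵘ.mkℚᵘ z 0)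

toℚ-+ : ∀ a b → toℚ (a ℤ.+ b) ≡ toℚ a + toℚ b
toℚ-+ a b = toℚᵘ-injective (begin
  toℚᵘ (toℚ (a ℤ.+ b))               ≈⟨ toℚᵘ-toℚ (a ℤ.+ b) ⟩
  ℚᵘ.mkℚᵘ (a ℤ.+ b) 0                ≈⟨ ℚᵘ.*≡* (cong (ℤ._* ℤ.+ 1) (cong₂ ℤ._+_ (ℤₚ.*-identityʳ a) (ℤₚ.*-identityʳ b))) ⟨
  ℚᵘ.mkℚᵘ a 0 ℚᵘ.+ ℚᵘ.mkℚᵘ b 0       ≈⟨ ℚᵘₚ.+-cong (toℚᵘ-toℚ a) (toℚᵘ-toℚ b) ⟨
  toℚᵘ (toℚ a) ℚᵘ.+ toℚᵘ (toℚ b)     ≈⟨ toℚᵘ-homo-+ (toℚ a) (toℚ b) ⟨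
  toℚᵘ (toℚ a + toℚ b)               ∎)
  where open ℚᵘₚ.≃-Reasoning

toℚ-neg : ∀ a → toℚ (ℤ.- a) ≡ - toℚ a
toℚ-neg a = toℚᵘ-injective (begin
  toℚᵘ (toℚ (ℤ.- a))      ≈⟨ toℚᵘ-toℚ (ℤ.- a) ⟩
  ℚᵘ.- ℚᵘ.mkℚᵘ a 0        ≈⟨ ℚᵘₚ.-‿cong (toℚᵘ-toℚ a) ⟨
  ℚᵘ.- toℚᵘ (toℚ a)       ≈⟨ toℚᵘ-homo‿- (toℚ a) ⟨
  toℚᵘ (- toℚ a)          ∎)
  where open ℚᵘₚ.≃-Reasoning

toℚ-mono-≤ : ∀ {a b} → a ℤ.≤ b → toℚ a ≤ toℚ b
toℚ-mono-≤ {a} {b} a≤b = toℚᵘ-cancel-≤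
  (ℚᵘₚ.≤-respˡ-≃ (ℚᵘₚ.≃-sym (toℚᵘ-toℚ a)) (ℚᵘₚ.≤-respʳ-≃ (ℚᵘₚ.≃-sym (toℚᵘ-toℚ b))
    (ℚᵘ.*≤* (subst₂ ℤ._≤_ (sym (ℤₚ.*-identityʳ a)) (sym (ℤₚ.*-identityʳ b)) a≤b))))

toℚ-cancel-< : ∀ {a b} → toℚ a < toℚ b → a ℤ.< b
toℚ-cancel-< {a} {b} a<b with ℚᵘₚ.<-respˡ-≃ (toℚᵘ-toℚ a) (ℚᵘₚ.<-respʳ-≃ (toℚᵘ-toℚ b) (toℚᵘ-mono-< a<b))
... | ℚᵘ.*<* a*1<b*1 = subst₂ ℤ._<_ (ℤₚ.*-identityʳ a) (ℤₚ.*-identityʳ b) a*1<b*1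

isInteger-0 : IsInteger 0ℚ
isInteger-0 = ℤ.+ 0 , refl

isInteger-+ : ∀ {p q} → IsInteger p → IsInteger q → IsInteger (p + q)
isInteger-+ (a , refl) (b , refl) = a ℤ.+ b , sym (toℚ-+ a b)

isInteger-difference : ∀ {p q} → IsInteger p → IsInteger q → IsInteger (p - q)
isInteger-difference p∈ℤ (b , refl) = isInteger-+ p∈ℤ (ℤ.- b , sym (toℚ-neg b))

isInteger-⊔ : ∀ {p q} → IsInteger p → IsInteger q → IsInteger (p ⊔ q)
isInteger-⊔ {p} {q} p∈ℤ q∈ℤ with ≤-total p q
... | inj₁ p≤q = subst IsInteger (sym (p≤q⇒p⊔q≡q p≤q)) q∈ℤ
... | inj₂ q≤p = subst IsInteger (sym (p≥q⇒p⊔q≡p q≤p)) p∈ℤ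

isInteger-sum : ∀ {xs : List ℚ} → All IsInteger xs → IsInteger (foldr _+_ 0ℚ xs)
isInteger-sum []           = isInteger-0
isInteger-sum (x∈ℤ ∷ xs∈ℤ) = isInteger-+ x∈ℤ (isInteger-sum xs∈ℤ)

negative-integer+fraction<0 : ∀ {p ε} → IsInteger p → p < 0ℚ → ε < 1ℚ → p + ε < 0ℚ
negative-integer+fraction<0 {ε = ε} (z , refl) z<0 ε<1 = begin-strict
  toℚ z + ε       <⟨ +-monoʳ-< (toℚ z) ε<1 ⟩
  toℚ z + 1ℚ      ≡⟨ +-comm (toℚ z) 1ℚ ⟩
  1ℚ + toℚ z      ≡⟨ toℚ-+ (ℤ.+ 1) z ⟨
  toℚ (ℤ.suc z)   ≤⟨ toℚ-mono-≤ {ℤ.suc z} (ℤₚ.i<j⇒suc[i]≤j (toℚ-cancel-< {z} {ℤ.+ 0} z<0)) ⟩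
  0ℚ              ∎
  where open ≤-Reasoning

cAt-isInteger : ∀ {d} (c : Fin d → ℤ) i → IsInteger (cAt c i)
cAt-isInteger c zero = isInteger-0
cAt-isInteger {d} c (suc i) with i ℕ.<? d
... | yes i<d = c (fromℕ< i<d) , refl
... | no  _   = isInteger-0

ℕtoℚ : ℕ → ℚ
ℕtoℚ n = toℚ (ℤ.+ n)

ℕtoℚ-+ : ∀ a b → ℕtoℚ (a ℕ.+ b) ≡ ℕtoℚ a + ℕtoℚ b
ℕtoℚ-+ a b = toℚ-+ (ℤ.+ a) (ℤ.+ b)

count : (ℕ → ℕ) → ℕ → ℕ
count f zero    = 0
count f (suc n) = count f n ℕ.+ f (suc n)

count-mono : ∀ f {a b} → a ℕ.≤ b → count f a ℕ.≤ count f b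
count-mono f {b = zero}  z≤n   = z≤n
count-mono f {a} {suc b} a≤1+b with ℕₚ.m≤n⇒m<n∨m≡n a≤1+b
... | inj₁ (s≤s a≤b) = ℕₚ.≤-trans (count-mono f a≤b) (ℕₚ.m≤m+n (count f b) (f (suc b)))
... | inj₂ refl      = ℕₚ.≤-refl

m≤n≤1+m⇒n≡m∨n≡1+m : ∀ {m n} → m ℕ.≤ n → n ℕ.≤ suc m → n ≡ m ⊎ n ≡ suc m
m≤n≤1+m⇒n≡m∨n≡1+m m≤n n≤1+m with ℕₚ.m≤n⇒m<n∨m≡n n≤1+m
... | inj₁ (s≤s n≤m) = inj₁ (ℕₚ.≤-antisym n≤m m≤n)
... | inj₂ n≡1+m     = inj₂ n≡1+m

isActive : (Δ : ℕ) → (ℕ → ℚ) → ℚ → ℚ → ℕ → ℕ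
isActive Δ c w₀ ε i = if ⌊ dualGreedy Δ c (w₀ - ε) i ≟ dualGreedy Δ c w₀ i + ε ⌋ then 1 else 0

-- The counting loop of activeCount is local to its where block.  Abstracting suc d and 2
-- turns the unfolded goal into a pattern, so unification names the loop activeCountFrom.
mutual
  activeCountFrom : (Δ d : ℕ) → (ℕ → ℚ) → ℚ → ℚ → ℕ → ℕ → ℕ
  activeCountFrom = _

  activeCount-suc : ∀ Δ d c w₀ ε →
    activeCount Δ (suc d) c w₀ ε ≡ isActive Δ c w₀ ε 1 ℕ.+ activeCountFrom Δ (suc d) c w₀ ε 2 d
  activeCount-suc Δ d c w₀ ε with suc d | 2
  ... | _ | _ = refl

count-activeCountFrom : ∀ Δ d c w₀ ε a n →
  count (isActive Δ c w₀ ε) a ℕ.+ activeCountFrom Δ d c w₀ ε (suc a) n ≡ count (isActive Δ c w₀ ε) (a ℕ.+ n)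
count-activeCountFrom Δ d c w₀ ε a zero = trans (ℕₚ.+-identityʳ _) (cong (count _) (sym (ℕₚ.+-identityʳ a)))
count-activeCountFrom Δ d c w₀ ε a (suc n) = begin
  count f a ℕ.+ (f (suc a) ℕ.+ activeCountFrom Δ d c w₀ ε (suc (suc a)) n)
    ≡⟨ ℕₚ.+-assoc (count f a) (f (suc a)) _ ⟨
  count f (suc a) ℕ.+ activeCountFrom Δ d c w₀ ε (suc (suc a)) n
    ≡⟨ count-activeCountFrom Δ d c w₀ ε (suc a) n ⟩
  count f (suc a ℕ.+ n)
    ≡⟨ cong (count f) (ℕₚ.+-suc a n) ⟨
  count f (a ℕ.+ suc n) ∎
  where
  f : ℕ → ℕ
  f = isActive Δ c w₀ ε
  open ≡-Reasoning

activeCount≡count : ∀ Δ d c w₀ ε → activeCount Δ d c w₀ ε ≡ count (isActive Δ c w₀ ε) d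
activeCount≡count Δ zero    c w₀ ε = refl
activeCount≡count Δ (suc d) c w₀ ε =
  trans (activeCount-suc Δ d c w₀ ε) (count-activeCountFrom Δ (suc d) c w₀ ε 1 d)

-- How far constraint m + 1 is from being covered before Dual-Greedy chooses w_{m+1};
-- dualGreedy Δ c w₀ (suc m) reduces to 0ℚ ⊔ deficit Δ c w₀ m.
deficit : (Δ : ℕ) → (ℕ → ℚ) → ℚ → ℕ → ℚ
deficit Δ c w₀ m = c (suc m) - (w₀ + foldr _+_ 0ℚ (take (Δ ∸ 1) (greedyList Δ c w₀ m)))

sum-take-greedyList : ∀ Δ c w₀ m t →
  foldr _+_ 0ℚ (take t (greedyList Δ c w₀ m)) ≡
    prefixSum (dualGreedy Δ c w₀) m - prefixSum (dualGreedy Δ c w₀) (m ∸ t)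
sum-take-greedyList Δ c w₀ zero    zero    = refl
sum-take-greedyList Δ c w₀ zero    (suc t) = refl
sum-take-greedyList Δ c w₀ (suc m) zero    = sym (+-inverseʳ (prefixSum (dualGreedy Δ c w₀) (suc m)))
sum-take-greedyList Δ c w₀ (suc m) (suc t) =
  trans (cong (w (suc m) +_) (sum-take-greedyList Δ c w₀ m t))
        (solve 3 (λ a b x → x :+ (a :- b) := (a :+ x) :- b) refl
          (prefixSum w m) (prefixSum w (m ∸ t)) (w (suc m)))
  where
  w : ℕ → ℚ
  w = dualGreedy Δ c w₀

deficit-prefixSum : ∀ D c w₀ m → let w = dualGreedy (suc D) c w₀ in
  deficit (suc D) c w₀ m ≡ c (suc m) - (w₀ + (prefixSum w m - prefixSum w (m ∸ D)))
deficit-prefixSum D c w₀ m = cong (λ s → c (suc m) - (w₀ + s)) (sum-take-greedyList (suc D) c w₀ m D)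

windowSum-dualGreedy : ∀ D c w₀ m → let w = dualGreedy (suc D) c w₀ in
  w₀ + windowSum (suc D) w (suc m) ≡ (c (suc m) - deficit (suc D) c w₀ m) + w (suc m)
windowSum-dualGreedy D c w₀ m = begin
  w₀ + windowSum (suc D) w (suc m)
    ≡⟨ cong (w₀ +_) (windowSum-prefixSum D w m) ⟩
  w₀ + ((prefixSum w m + w (suc m)) - prefixSum w (m ∸ D))
    ≡⟨ solve 5 (λ l a b x γ → l :+ ((a :+ x) :- b) := (γ :- (γ :- (l :+ (a :- b)))) :+ x) refl
         w₀ (prefixSum w m) (prefixSum w (m ∸ D)) (w (suc m)) (c (suc m)) ⟩
  (c (suc m) - (c (suc m) - (w₀ + (prefixSum w m - prefixSum w (m ∸ D))))) + w (suc m)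
    ≡⟨ cong (λ δ → (c (suc m) - δ) + w (suc m)) (deficit-prefixSum D c w₀ m) ⟨
  (c (suc m) - deficit (suc D) c w₀ m) + w (suc m) ∎
  where
  w : ℕ → ℚ
  w = dualGreedy (suc D) c w₀
  open ≡-Reasoning

p-q+q≡p : ∀ p q → (p - q) + q ≡ p
p-q+q≡p = solve 2 (λ p q → (p :- q) :+ q := p) refl

dualGreedy-slack : ∀ D c w₀ m → deficit (suc D) c w₀ m < 0ℚ →
  dualGreedy (suc D) c w₀ (suc m) ≡ 0ℚ
dualGreedy-slack D c w₀ m δ<0 = p≥q⇒p⊔q≡p (<⇒≤ δ<0)

dualGreedy-covered : ∀ D c w₀ m → 0ℚ ≤ deficit (suc D) c w₀ m →
  dualGreedy (suc D) c w₀ (suc m) ≡ deficit (suc D) c w₀ m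
dualGreedy-covered D c w₀ m δ≥0 = p≤q⇒p⊔q≡q δ≥0

dualGreedy-tight : ∀ D c w₀ m → 0ℚ ≤ deficit (suc D) c w₀ m →
  w₀ + windowSum (suc D) (dualGreedy (suc D) c w₀) (suc m) ≡ c (suc m)
dualGreedy-tight D c w₀ m δ≥0 = begin
  w₀ + windowSum (suc D) (dualGreedy (suc D) c w₀) (suc m)   ≡⟨ windowSum-dualGreedy D c w₀ m ⟩
  (c (suc m) - δ) + dualGreedy (suc D) c w₀ (suc m)          ≡⟨ cong ((c (suc m) - δ) +_) (dualGreedy-covered D c w₀ m δ≥0) ⟩
  (c (suc m) - δ) + δ                                        ≡⟨ p-q+q≡p (c (suc m)) δ ⟩
  c (suc m)                                                  ∎
  where
  δ : ℚ
  δ = deficit (suc D) c w₀ m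
  open ≡-Reasoning

dualGreedy-feasible : ∀ D c w₀ d → Feasible (suc D) d c w₀ (dualGreedy (suc D) c w₀)
dualGreedy-feasible D c w₀ d = covers , nonneg
  where
  covers : ∀ i → 1 ℕ.≤ i → i ℕ.≤ d → c i ≤ w₀ + windowSum (suc D) (dualGreedy (suc D) c w₀) i
  covers (suc m) _ _ = begin
    c (suc m)                                               ≡⟨ p-q+q≡p (c (suc m)) δ ⟨
    (c (suc m) - δ) + δ                                     ≤⟨ +-monoʳ-≤ (c (suc m) - δ) (p≤q⊔p 0ℚ δ) ⟩
    (c (suc m) - δ) + dualGreedy (suc D) c w₀ (suc m)       ≡⟨ windowSum-dualGreedy D c w₀ m ⟨
    w₀ + windowSum (suc D) (dualGreedy (suc D) c w₀) (suc m) ∎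
    where
    δ : ℚ
    δ = deficit (suc D) c w₀ m
    open ≤-Reasoning
  nonneg : ∀ i → 1 ℕ.≤ i → i ℕ.≤ d → 0ℚ ≤ dualGreedy (suc D) c w₀ i
  nonneg (suc m) _ _ = p≤p⊔q 0ℚ (deficit (suc D) c w₀ m)

module _ (Δ : ℕ) {c : ℕ → ℚ} {w₀ : ℚ} (c∈ℤ : ∀ i → IsInteger (c i)) (w₀∈ℤ : IsInteger w₀) where

  greedyList-isInteger : ∀ i → All IsInteger (greedyList Δ c w₀ i)
  deficit-isInteger    : ∀ m → IsInteger (deficit Δ c w₀ m)

  greedyList-isInteger zero    = []
  greedyList-isInteger (suc i) = isInteger-⊔ isInteger-0 (deficit-isInteger i) ∷ greedyList-isInteger i

  deficit-isInteger m =
    isInteger-difference (c∈ℤ (suc m)) (isInteger-+ w₀∈ℤ (isInteger-sum (take⁺ (Δ ∸ 1) (greedyList-isInteger m))))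

objective-prefixSum : ∀ k n w₀ w → objective k n w₀ w ≡ w₀ * ℕtoℚ k + prefixSum w n
objective-prefixSum k n w₀ w = cong (w₀ * ℕtoℚ k +_) (sumFrom-one w n)

objective-suc : ∀ k m w₀ w → objective k (suc m) w₀ w ≡ objective k m w₀ w + w (suc m)
objective-suc k m w₀ w = begin
  objective k (suc m) w₀ w                        ≡⟨ objective-prefixSum k (suc m) w₀ w ⟩
  w₀ * ℕtoℚ k + (prefixSum w m + w (suc m))       ≡⟨ +-assoc (w₀ * ℕtoℚ k) (prefixSum w m) (w (suc m)) ⟨
  (w₀ * ℕtoℚ k + prefixSum w m) + w (suc m)       ≡⟨ cong (_+ w (suc m)) (objective-prefixSum k m w₀ w) ⟨
  objective k m w₀ w + w (suc m)                  ∎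
  where open ≡-Reasoning

objective-window : ∀ D k m w₀ w →
  objective (suc k) (suc m) w₀ w ≡ objective k (m ∸ D) w₀ w + (w₀ + windowSum (suc D) w (suc m))
objective-window D k m w₀ w = begin
  objective (suc k) (suc m) w₀ w
    ≡⟨ objective-prefixSum (suc k) (suc m) w₀ w ⟩
  w₀ * ℕtoℚ (1 ℕ.+ k) + prefixSum w (suc m)
    ≡⟨ cong (λ x → w₀ * x + prefixSum w (suc m)) (ℕtoℚ-+ 1 k) ⟩
  w₀ * (1ℚ + ℕtoℚ k) + prefixSum w (suc m)
    ≡⟨ solve 4 (λ l x a b → l :* (con 1ℚ :+ x) :+ a := (l :* x :+ b) :+ (l :+ (a :- b))) refl
         w₀ (ℕtoℚ k) (prefixSum w (suc m)) (prefixSum w (m ∸ D)) ⟩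
  (w₀ * ℕtoℚ k + prefixSum w (m ∸ D)) + (w₀ + (prefixSum w (suc m) - prefixSum w (m ∸ D)))
    ≡⟨ cong₂ (λ x y → x + (w₀ + y)) (objective-prefixSum k (m ∸ D) w₀ w) (windowSum-prefixSum D w m) ⟨
  objective k (m ∸ D) w₀ w + (w₀ + windowSum (suc D) w (suc m)) ∎
  where open ≡-Reasoning

-- Complementary slackness, one constraint at a time, between (w₀, w) and the primal solution
-- selecting the constraints at which A increases.
CoveringStep : (D : ℕ) → (ℕ → ℚ) → ℚ → (ℕ → ℚ) → (ℕ → ℕ) → ℕ → Set
CoveringStep D c w₀ w A m =
  (w (suc m) ≡ 0ℚ × A (suc m) ≡ A m) ⊎
  (w₀ + windowSum (suc D) w (suc m) ≡ c (suc m) × A (suc m) ≡ suc (A (m ∸ D)))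

objective-≤-feasible : ∀ D c w₀ w (A : ℕ → ℕ) d → A 0 ≡ 0 →
  (∀ m → suc m ℕ.≤ d → CoveringStep D c w₀ w A m) →
  ∀ v₀ v → Feasible (suc D) d c v₀ v → objective (A d) d w₀ w ≤ objective (A d) d v₀ v
objective-≤-feasible D c w₀ w A d A0≡0 steps v₀ v (covers , nonneg) = <-rec P bound d ℕₚ.≤-refl
  where
  P : ℕ → Set
  P n = n ℕ.≤ d → objective (A n) n w₀ w ≤ objective (A n) n v₀ v

  bound : ∀ n → (∀ {m} → m ℕ.< n → P m) → P n
  bound zero _ _ rewrite A0≡0 =
    ≤-reflexive (trans (cong (_+ 0ℚ) (*-zeroʳ w₀)) (sym (cong (_+ 0ℚ) (*-zeroʳ v₀))))
  bound (suc m) rec 1+m≤d with steps m 1+m≤d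
  ... | inj₁ (w≡0 , A≡) rewrite A≡ = begin
    objective (A m) (suc m) w₀ w       ≡⟨ objective-suc (A m) m w₀ w ⟩
    objective (A m) m w₀ w + w (suc m) ≤⟨ +-mono-≤ (rec (ℕₚ.n<1+n m) (ℕₚ.<⇒≤ 1+m≤d))
                                            (≤-trans (≤-reflexive w≡0) (nonneg (suc m) (s≤s z≤n) 1+m≤d)) ⟩
    objective (A m) m v₀ v + v (suc m) ≡⟨ objective-suc (A m) m v₀ v ⟨
    objective (A m) (suc m) v₀ v       ∎
    where open ≤-Reasoning
  ... | inj₂ (tight , A≡) rewrite A≡ = begin
    objective (suc a) (suc m) w₀ w
      ≡⟨ objective-window D a m w₀ w ⟩
    objective a (m ∸ D) w₀ w + (w₀ + windowSum (suc D) w (suc m))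
      ≤⟨ +-mono-≤ (rec (s≤s (ℕₚ.m∸n≤m m D)) (ℕₚ.≤-trans (ℕₚ.m∸n≤m m D) (ℕₚ.<⇒≤ 1+m≤d)))
                  (≤-trans (≤-reflexive tight) (covers (suc m) (s≤s z≤n) 1+m≤d)) ⟩
    objective a (m ∸ D) v₀ v + (v₀ + windowSum (suc D) v (suc m))
      ≡⟨ objective-window D a m v₀ v ⟨
    objective (suc a) (suc m) v₀ v ∎
    where
    a : ℕ
    a = A (m ∸ D)
    open ≤-Reasoning

module Perturbation (D : ℕ) (c : ℕ → ℚ) (w₀ ε : ℚ) (0<ε : 0ℚ < ε) (ε<1 : ε < 1ℚ)
                    (deficit∈ℤ : ∀ m → IsInteger (deficit (suc D) c w₀ m)) where

  g : ℕ → ℚ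
  g = dualGreedy (suc D) c w₀

  h : ℕ → ℚ
  h = dualGreedy (suc D) c (w₀ - ε)

  δ : ℕ → ℚ
  δ = deficit (suc D) c w₀

  δ′ : ℕ → ℚ
  δ′ = deficit (suc D) c (w₀ - ε)

  activeAt : ℕ → ℕ
  activeAt = isActive (suc D) c w₀ ε

  activeUpTo : ℕ → ℕ
  activeUpTo = count activeAt

  h≡g⇒activeAt≡0 : ∀ i → h i ≡ g i → activeAt i ≡ 0
  h≡g⇒activeAt≡0 i h≡g with h i ≟ g i + ε
  ... | yes h≡g+ε = contradiction (sym (identityʳ-unique (g i) ε (trans (sym h≡g+ε) h≡g))) (<⇒≢ 0<ε)
  ... | no  _     = refl

  h≡g+ε⇒activeAt≡1 : ∀ i → h i ≡ g i + ε → activeAt i ≡ 1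
  h≡g+ε⇒activeAt≡1 i h≡g+ε with h i ≟ g i + ε
  ... | yes _     = refl
  ... | no  h≢g+ε = contradiction h≡g+ε h≢g+ε

  ShiftedAt : ℕ → Set
  ShiftedAt i = h i ≡ g i + ε * ℕtoℚ (activeAt i)

  h≡g⇒shiftedAt : ∀ i → h i ≡ g i → ShiftedAt i
  h≡g⇒shiftedAt i h≡g rewrite h≡g⇒activeAt≡0 i h≡g =
    trans h≡g (sym (trans (cong (g i +_) (*-zeroʳ ε)) (+-identityʳ (g i))))

  h≡g+ε⇒shiftedAt : ∀ i → h i ≡ g i + ε → ShiftedAt i
  h≡g+ε⇒shiftedAt i h≡g+ε rewrite h≡g+ε⇒activeAt≡1 i h≡g+ε =
    trans h≡g+ε (cong (g i +_) (sym (*-identityʳ ε)))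

  activeUpTo-suc-0 : ∀ m → activeAt (suc m) ≡ 0 → activeUpTo (suc m) ≡ activeUpTo m
  activeUpTo-suc-0 m a≡0 = trans (cong (activeUpTo m ℕ.+_) a≡0) (ℕₚ.+-identityʳ (activeUpTo m))

  activeUpTo-suc-1 : ∀ m → activeAt (suc m) ≡ 1 → activeUpTo (suc m) ≡ suc (activeUpTo m)
  activeUpTo-suc-1 m a≡1 = trans (cong (activeUpTo m ℕ.+_) a≡1) (ℕₚ.+-comm (activeUpTo m) 1)

  PrefixShifted : ℕ → Set
  PrefixShifted j = prefixSum h j ≡ prefixSum g j + ε * ℕtoℚ (activeUpTo j)

  prefixShifted-zero : PrefixShifted 0
  prefixShifted-zero = sym (trans (+-identityˡ (ε * 0ℚ)) (*-zeroʳ ε))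

  prefixShifted-suc : ∀ m → PrefixShifted m → ShiftedAt (suc m) → PrefixShifted (suc m)
  prefixShifted-suc m shm sh = begin
    prefixSum h m + h (suc m)
      ≡⟨ cong₂ _+_ shm sh ⟩
    (prefixSum g m + ε * ℕtoℚ (activeUpTo m)) + (g (suc m) + ε * ℕtoℚ (activeAt (suc m)))
      ≡⟨ solve 5 (λ s e x y z → (s :+ e :* x) :+ (y :+ e :* z) := (s :+ y) :+ e :* (x :+ z)) refl
           (prefixSum g m) ε (ℕtoℚ (activeUpTo m)) (g (suc m)) (ℕtoℚ (activeAt (suc m))) ⟩
    prefixSum g (suc m) + ε * (ℕtoℚ (activeUpTo m) + ℕtoℚ (activeAt (suc m)))
      ≡⟨ cong (λ x → prefixSum g (suc m) + ε * x) (ℕtoℚ-+ (activeUpTo m) (activeAt (suc m))) ⟨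
    prefixSum g (suc m) + ε * ℕtoℚ (activeUpTo (suc m)) ∎
    where open ≡-Reasoning

  deficit-perturbed : ∀ m k → PrefixShifted m → PrefixShifted (m ∸ D) →
    activeUpTo m ≡ k ℕ.+ activeUpTo (m ∸ D) → δ′ m ≡ δ m + ε * (1ℚ - ℕtoℚ k)
  deficit-perturbed m k shm shd window≡k = begin
    δ′ m
      ≡⟨ deficit-prefixSum D c (w₀ - ε) m ⟩
    c (suc m) - ((w₀ - ε) + (prefixSum h m - prefixSum h (m ∸ D)))
      ≡⟨ cong₂ (λ x y → c (suc m) - ((w₀ - ε) + (x - y))) shm shd ⟩
    c (suc m) - ((w₀ - ε) + ((prefixSum g m + ε * ℕtoℚ (activeUpTo m)) - (prefixSum g (m ∸ D) + ε * u)))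
      ≡⟨ cong (λ x → c (suc m) - ((w₀ - ε) + ((prefixSum g m + ε * x) - (prefixSum g (m ∸ D) + ε * u))))
           (trans (cong ℕtoℚ window≡k) (ℕtoℚ-+ k (activeUpTo (m ∸ D)))) ⟩
    c (suc m) - ((w₀ - ε) + ((prefixSum g m + ε * (ℕtoℚ k + u)) - (prefixSum g (m ∸ D) + ε * u)))
      ≡⟨ solve 7 (λ γ l e s t x y → γ :- ((l :- e) :+ ((s :+ e :* (x :+ y)) :- (t :+ e :* y)))
                                   := (γ :- (l :+ (s :- t))) :+ e :* (con 1ℚ :- x)) refl
           (c (suc m)) w₀ ε (prefixSum g m) (prefixSum g (m ∸ D)) (ℕtoℚ k) u ⟩
    (c (suc m) - (w₀ + (prefixSum g m - prefixSum g (m ∸ D)))) + ε * (1ℚ - ℕtoℚ k)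
      ≡⟨ cong (λ x → x + ε * (1ℚ - ℕtoℚ k)) (deficit-prefixSum D c w₀ m) ⟨
    δ m + ε * (1ℚ - ℕtoℚ k) ∎
    where
    u : ℚ
    u = ℕtoℚ (activeUpTo (m ∸ D))
    open ≡-Reasoning

  record Step (m : ℕ) : Set where
    field
      shifted  : ShiftedAt (suc m)
      packed   : activeUpTo (suc m) ℕ.≤ suc (activeUpTo (m ∸ D))
      covering : CoveringStep D c w₀ g activeUpTo m

  step-blocked : ∀ m → PrefixShifted m → PrefixShifted (m ∸ D) →
    activeUpTo m ≡ suc (activeUpTo (m ∸ D)) → Step m
  step-blocked m shm shd blocked = record
    { shifted  = h≡g⇒shiftedAt (suc m) h≡g
    ; packed   = ℕₚ.≤-reflexive count≡
    ; covering = covering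
    }
    where
    h≡g : h (suc m) ≡ g (suc m)
    h≡g = cong (0ℚ ⊔_) (begin
      δ′ m                ≡⟨ deficit-perturbed m 1 shm shd blocked ⟩
      δ m + ε * (1ℚ - 1ℚ) ≡⟨ cong (δ m +_) (*-zeroʳ ε) ⟩
      δ m + 0ℚ            ≡⟨ +-identityʳ (δ m) ⟩
      δ m                 ∎)
      where open ≡-Reasoning
    unchanged : activeUpTo (suc m) ≡ activeUpTo m
    unchanged = activeUpTo-suc-0 m (h≡g⇒activeAt≡0 (suc m) h≡g)
    count≡ : activeUpTo (suc m) ≡ suc (activeUpTo (m ∸ D))
    count≡ = trans unchanged blocked
    covering : CoveringStep D c w₀ g activeUpTo m
    covering with 0ℚ ≤? δ m
    ... | yes δ≥0 = inj₂ (dualGreedy-tight D c w₀ m δ≥0 , count≡)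
    ... | no  δ≱0 = inj₁ (dualGreedy-slack D c w₀ m (≰⇒> δ≱0) , unchanged)

  step-covered : ∀ m → PrefixShifted m → PrefixShifted (m ∸ D) →
    activeUpTo m ≡ activeUpTo (m ∸ D) → 0ℚ ≤ δ m → Step m
  step-covered m shm shd free δ≥0 = record
    { shifted  = h≡g+ε⇒shiftedAt (suc m) h≡g+ε
    ; packed   = ℕₚ.≤-reflexive count≡
    ; covering = inj₂ (dualGreedy-tight D c w₀ m δ≥0 , count≡)
    }
    where
    h≡g+ε : h (suc m) ≡ g (suc m) + ε
    h≡g+ε = begin
      0ℚ ⊔ δ′ m           ≡⟨ cong (0ℚ ⊔_) (deficit-perturbed m 0 shm shd free) ⟩
      0ℚ ⊔ (δ m + ε * 1ℚ) ≡⟨ cong (λ x → 0ℚ ⊔ (δ m + x)) (*-identityʳ ε) ⟩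
      0ℚ ⊔ (δ m + ε)      ≡⟨ p≤q⇒p⊔q≡q (+-mono-≤ δ≥0 (<⇒≤ 0<ε)) ⟩
      δ m + ε             ≡⟨ cong (_+ ε) (dualGreedy-covered D c w₀ m δ≥0) ⟨
      g (suc m) + ε       ∎
      where open ≡-Reasoning
    count≡ : activeUpTo (suc m) ≡ suc (activeUpTo (m ∸ D))
    count≡ = trans (activeUpTo-suc-1 m (h≡g+ε⇒activeAt≡1 (suc m) h≡g+ε)) (cong suc free)

  step-slack : ∀ m → PrefixShifted m → PrefixShifted (m ∸ D) →
    activeUpTo m ≡ activeUpTo (m ∸ D) → δ m < 0ℚ → Step m
  step-slack m shm shd free δ<0 = record
    { shifted  = h≡g⇒shiftedAt (suc m) h≡g
    ; packed   = ℕₚ.≤-trans (ℕₚ.≤-reflexive (trans unchanged free)) (ℕₚ.n≤1+n (activeUpTo (m ∸ D)))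
    ; covering = inj₁ (dualGreedy-slack D c w₀ m δ<0 , unchanged)
    }
    where
    h≡g : h (suc m) ≡ g (suc m)
    h≡g = begin
      0ℚ ⊔ δ′ m           ≡⟨ cong (0ℚ ⊔_) (deficit-perturbed m 0 shm shd free) ⟩
      0ℚ ⊔ (δ m + ε * 1ℚ) ≡⟨ cong (λ x → 0ℚ ⊔ (δ m + x)) (*-identityʳ ε) ⟩
      0ℚ ⊔ (δ m + ε)      ≡⟨ p≥q⇒p⊔q≡p (<⇒≤ (negative-integer+fraction<0 (deficit∈ℤ m) δ<0 ε<1)) ⟩
      0ℚ                  ≡⟨ dualGreedy-slack D c w₀ m δ<0 ⟨
      g (suc m)           ∎
      where open ≡-Reasoning
    unchanged : activeUpTo (suc m) ≡ activeUpTo m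
    unchanged = activeUpTo-suc-0 m (h≡g⇒activeAt≡0 (suc m) h≡g)

  step-window : ∀ m → PrefixShifted m → PrefixShifted (m ∸ D) →
    activeUpTo m ℕ.≤ suc (activeUpTo (m ∸ D)) → Step m
  step-window m shm shd upper with m≤n≤1+m⇒n≡m∨n≡1+m (count-mono activeAt (ℕₚ.m∸n≤m m D)) upper
  ... | inj₂ blocked = step-blocked m shm shd blocked
  ... | inj₁ free with 0ℚ ≤? δ m
  ...   | yes δ≥0 = step-covered m shm shd free δ≥0
  ...   | no  δ≱0 = step-slack m shm shd free (≰⇒> δ≱0)

  Invariant : ℕ → Set
  Invariant n = (∀ j → j ℕ.≤ n → PrefixShifted j) × activeUpTo n ℕ.≤ suc (activeUpTo (n ∸ suc D))

  step : ∀ m → Invariant m → Step m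
  step m (shifted , packed) = step-window m (shifted m ℕₚ.≤-refl) (shifted (m ∸ D) (ℕₚ.m∸n≤m m D))
    (ℕₚ.≤-trans packed (s≤s (count-mono activeAt (ℕₚ.∸-monoʳ-≤ m (ℕₚ.n≤1+n D)))))

  invariant : ∀ n → Invariant n
  invariant zero    = (λ { zero z≤n → prefixShifted-zero }) , z≤n
  invariant (suc m) = shifted , Step.packed s
    where
    s : Step m
    s = step m (invariant m)
    shifted : ∀ j → j ℕ.≤ suc m → PrefixShifted j
    shifted j j≤1+m with ℕₚ.m≤n⇒m<n∨m≡n j≤1+m
    ... | inj₁ (s≤s j≤m) = proj₁ (invariant m) j j≤m
    ... | inj₂ refl      = prefixShifted-suc m (proj₁ (invariant m) m ℕₚ.≤-refl) (Step.shifted s)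

lemma6 : (Δ k d : ℕ) → 1 ℕ.≤ Δ → 1 ℕ.≤ k →
    (c : Fin d → ℤ) (lam : ℤ) (ε : ℚ) → 0ℚ < ε → ε < 1ℚ →
    activeCount Δ d (cAt c) (toℚ lam) ε ≡ k →
    Optimal Δ k d (cAt c) (toℚ lam) (dualGreedy Δ (cAt c) (toℚ lam))
lemma6 (suc D) k d (s≤s z≤n) _ c lam ε 0<ε ε<1 activeCount≡k =
  dualGreedy-feasible D (cAt c) (toℚ lam) d , optimal
  where
  open Perturbation D (cAt c) (toℚ lam) ε 0<ε ε<1
         (deficit-isInteger (suc D) (cAt-isInteger c) (lam , refl))
  active≡k : activeUpTo d ≡ k
  active≡k = trans (sym (activeCount≡count (suc D) d (cAt c) (toℚ lam) ε)) activeCount≡k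
  optimal : ∀ v₀ v → Feasible (suc D) d (cAt c) v₀ v →
    objective k d (toℚ lam) g ≤ objective k d v₀ v
  optimal v₀ v feasible = subst (λ n → objective n d (toℚ lam) g ≤ objective n d v₀ v) active≡k
    (objective-≤-feasible D (cAt c) (toℚ lam) g activeUpTo d refl
      (λ m _ → Step.covering (step m (invariant m))) v₀ v feasible)
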